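{- Let $\Gamma\subseteq\mathcal{L}$ be strongly compositional and let $\pi$ be any maximal $\models^*$-model of $\Gamma$. Then $\Gamma$ is consistent if and only if $\pi\models\Gamma$.
   Context: Let $V$ be a finite set of variables, each $X\in V$ having a finite nonempty domain $\underline{X}$. An outcome is an assignment of a value in $\underline{X}$ to every $X\in V$; for an outcome $\alpha$ and $U\subseteq V$, $\alpha(U)$ denotes the restriction. A lexicographic model (lex model) $\pi$ is a (possibly empty) finite sequence $(Y_1,\ge_{Y_1}),\ldots,(Y_k,\ge_{Y_k})$ of pairs with pairwise distinct $Y_i\in V$ and each $\ge_{Y_i}$ a total order on $\underline{Y_i}$; $V_\pi=\{Y_1,\ldots,Y_k\}$; $\mathcal{G}$ is the set of lex models. For lex models $\pi$ and $\pi'=(Z_1,\ge_{Z_1}),\ldots,(Z_l,\ge_{Z_l})$, $\pi\circ\pi'$ is $\pi$ followed by $\pi'$ with every pair $(Z_i,\ge_{Z_i})$ with $Z_i\in V_\pi$ deleted. $\pi'$ extends $\pi$ if $\pi'\neq\pi$ and the sequence $\pi'$ begins with $\pi$; $\pi'\sqsupseteq\pi$ means extends or equals. $\mathcal{L}$ is an arbitrary set of statements with a satisfaction relation $\models\ \subseteq\mathcal{G}\times\mathcal{L}$; $\pi\models\Gamma$ means $\pi\models\varphi$ for all $\varphi\in\Gamma$; $\Gamma$ is consistent if some $\pi\in\mathcal{G}$ satisfies $\Gamma$. $\pi\models^*\varphi$ iff some $\pi'\sqsupseteq\pi$ satisfies $\pi'\models\varphi$; $\pi\models^*\Gamma$ iff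 $\pi\models^*\varphi$ for all $\varphi\in\Gamma$. A maximal $\models^*$-model of $\Gamma$ is a $\pi$ with $\pi\models^*\Gamma$ such that no lex model extending $\pi$ $\models^*$-satisfies $\Gamma$. $\varphi$ is strongly compositional if for all $\pi,\pi'\in\mathcal{G}$, $\pi\models^*\varphi$ and $\pi'\models\varphi$ imply $\pi\circ\pi'\models\varphi$; $\Gamma$ is strongly compositional if all its elements are. -}

module Defs where

open import Data.Nat using (ℕ; _≤_)
open import Data.Fin using (Fin; _≟_)
open import Data.List using (List; []; _∷_; _++_; map)
open import Data.List.Relation.Unary.Unique.Propositional using (Unique)
open import Data.List.Membership.Propositional using (_∈_; _∉_)
open import Data.Product using (Σ; ∃; _×_; _,_; proj₁)
open import Relation.Nullary using (¬_; yes; no)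
open import Relation.Binary.PropositionalEquality using (_≡_; _≢_)

-- Variables: V = Fin n.  Domain of variable X: Fin (D X) (nonemptiness is a
-- hypothesis of the theorem: ∀ X → 1 ≤ D X).

-- A total order on the finite set Fin m, encoded as the list of all its
-- elements from best to worst (no repetitions, every element occurs).
RawOrder : ℕ → Set
RawOrder m = List (Fin m)

IsTotalOrder : {m : ℕ} → RawOrder m → Set
IsTotalOrder {m} o = Unique o × (∀ (a : Fin m) → a ∈ o)

module Lex (n : ℕ) (D : Fin n → ℕ) where

  open import Data.List.Membership.DecPropositional (_≟_ {n}) using (_∈?_)

  Pair : Set
  Pair = Σ (Fin n) (λ Y → RawOrder (D Y))

  Seq : Set
  Seq = List Pair

  vars : Seq → List (Fin n)
  vars = map proj₁

  data AllOrders : Seq → Set where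
    []  : AllOrders []
    _∷_ : ∀ {Y o π} → IsTotalOrder {D Y} o → AllOrders π → AllOrders ((Y , o) ∷ π)

  IsLexModel : Seq → Set
  IsLexModel π = Unique (vars π) × AllOrders π

  deleteVars : List (Fin n) → Seq → Seq
  deleteVars vs [] = []
  deleteVars vs ((Z , o) ∷ π') with Z ∈? vs
  ... | yes _ = deleteVars vs π'
  ... | no  _ = (Z , o) ∷ deleteVars vs π'

  _∘ˡ_ : Seq → Seq → Seq
  π ∘ˡ π' = π ++ deleteVars (vars π) π'

  _⊒_ : Seq → Seq → Set
  π' ⊒ π = ∃ λ rest → π' ≡ π ++ rest

  Extends : Seq → Seq → Set
  Extends π' π = (π' ≢ π) × (π' ⊒ π)

  module Sat (L : Set) (_⊨_ : Seq → L → Set) where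

    _⊨Γ_ : Seq → (L → Set) → Set
    π ⊨Γ Γ = ∀ φ → Γ φ → π ⊨ φ

    Consistent : (L → Set) → Set
    Consistent Γ = ∃ λ π → IsLexModel π × (π ⊨Γ Γ)

    _⊨*_ : Seq → L → Set
    π ⊨* φ = ∃ λ π' → IsLexModel π' × (π' ⊒ π) × (π' ⊨ φ)

    _⊨*Γ_ : Seq → (L → Set) → Set
    π ⊨*Γ Γ = ∀ φ → Γ φ → π ⊨* φ

    MaximalStarModel : (L → Set) → Seq → Set
    MaximalStarModel Γ π =
      IsLexModel π × (π ⊨*Γ Γ) ×
      (∀ π' → IsLexModel π' → Extends π' π → ¬ (π' ⊨*Γ Γ))

    StronglyCompositional : L → Set
    StronglyCompositional φ =
      ∀ π π' → IsLexModel π → IsLexModel π' →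
        π ⊨* φ → π' ⊨ φ → (π ∘ˡ π') ⊨ φ

    StronglyCompositionalSet : (L → Set) → Set
    StronglyCompositionalSet Γ = ∀ φ → Γ φ → StronglyCompositional φ

{-# OPTIONS --safe #-}
module Submission where

-- If π₀ satisfies Γ, strong compositionality makes π ∘ π₀ satisfy Γ. Being a
-- lex model that begins with π, it ⊨*-satisfies Γ, so by maximality of π it
-- cannot properly extend π: it is π itself. The converse holds with π as witness.

open import Defs
open import Data.Nat using (ℕ; _≤_)
open import Data.Fin using (Fin; _≟_)
open import Data.Product using (_×_; _,_; proj₁)
open import Data.List using ([]; _∷_; _++_)
open import Data.List.Properties using (map-++; ++-identityʳ; ++-identityʳ-unique)
open import Data.List.Relation.Unary.All using (All; []; _∷_)
open import Data.List.Relation.Unary.Any using (here; there)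
open import Data.List.Relation.Unary.Unique.Propositional using (Unique; []; _∷_)
open import Data.List.Relation.Unary.Unique.Propositional.Properties using (++⁺)
open import Data.List.Membership.Propositional using (_∈_; _∉_)
open import Data.Empty using (⊥-elim)
open import Relation.Nullary using (yes; no)
open import Relation.Binary.PropositionalEquality using (_≡_; _≢_; refl; sym; subst)

module LexModels (n : ℕ) (D : Fin n → ℕ) where
  open Lex n D
  open import Data.List.Membership.DecPropositional (_≟_ {n}) using (_∈?_)

  deleteVars-all : ∀ {P : Fin n → Set} vs π → All P (vars π) → All P (vars (deleteVars vs π))
  deleteVars-all vs [] [] = []
  deleteVars-all vs ((Z , _) ∷ π) (pZ ∷ pπ) with Z ∈? vs
  ... | yes _ = deleteVars-all vs π pπ
  ... | no  _ = pZ ∷ deleteVars-all vs π pπ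

  deleteVars-fresh : ∀ {v} vs π → v ∈ vars (deleteVars vs π) → v ∉ vs
  deleteVars-fresh vs ((Z , _) ∷ π) v∈ with Z ∈? vs | v∈
  ... | yes _   | v∈       = deleteVars-fresh vs π v∈
  ... | no  Z∉  | here refl = Z∉
  ... | no  _   | there v∈ = deleteVars-fresh vs π v∈

  deleteVars-unique : ∀ vs π → Unique (vars π) → Unique (vars (deleteVars vs π))
  deleteVars-unique vs [] [] = []
  deleteVars-unique vs ((Z , _) ∷ π) (Z∉π ∷ uπ) with Z ∈? vs
  ... | yes _ = deleteVars-unique vs π uπ
  ... | no  _ = deleteVars-all vs π Z∉π ∷ deleteVars-unique vs π uπ

  deleteVars-allOrders : ∀ vs π → AllOrders π → AllOrders (deleteVars vs π)
  deleteVars-allOrders vs [] [] = []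
  deleteVars-allOrders vs ((Z , _) ∷ π) (oZ ∷ oπ) with Z ∈? vs
  ... | yes _ = deleteVars-allOrders vs π oπ
  ... | no  _ = oZ ∷ deleteVars-allOrders vs π oπ

  allOrders-++ : ∀ π π′ → AllOrders π → AllOrders π′ → AllOrders (π ++ π′)
  allOrders-++ []      π′ []       o′ = o′
  allOrders-++ (_ ∷ π) π′ (oY ∷ o) o′ = oY ∷ allOrders-++ π π′ o o′

  ∘ˡ-isLexModel : ∀ π π′ → IsLexModel π → IsLexModel π′ → IsLexModel (π ∘ˡ π′)
  ∘ˡ-isLexModel π π′ (u , o) (u′ , o′) = unique , allOrders-++ π rest o (deleteVars-allOrders (vars π) π′ o′)
    where
    rest : Seq
    rest = deleteVars (vars π) π′

    unique : Unique (vars (π ++ rest))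
    unique = subst Unique (sym (map-++ proj₁ π rest))
      (++⁺ u (deleteVars-unique (vars π) π′ u′) λ (v∈π , v∈rest) → deleteVars-fresh (vars π) π′ v∈rest v∈π)

  ⊒-refl : ∀ π → π ⊒ π
  ⊒-refl π = [] , sym (++-identityʳ π)

  ∘ˡ-⊒ : ∀ π π′ → (π ∘ˡ π′) ⊒ π
  ∘ˡ-⊒ π π′ = deleteVars (vars π) π′ , refl

  module Satisfaction (L : Set) (_⊨_ : Seq → L → Set) where
    open Sat L _⊨_

    ⊨Γ⇒⊨*Γ : ∀ {Γ π} → IsLexModel π → π ⊨Γ Γ → π ⊨*Γ Γ
    ⊨Γ⇒⊨*Γ {π = π} lex sat φ γ = π , lex , ⊒-refl π , sat φ γ

    ∘ˡ-⊨Γ : ∀ {Γ} → StronglyCompositionalSet Γ → ∀ {π π′} → IsLexModel π → IsLexModel π′ →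
            π ⊨*Γ Γ → π′ ⊨Γ Γ → (π ∘ˡ π′) ⊨Γ Γ
    ∘ˡ-⊨Γ sc {π} {π′} lex lex′ star sat φ γ = sc φ γ π π′ lex lex′ (star φ γ) (sat φ γ)

    maximal-⊒⇒≡ : ∀ {Γ π π′} → MaximalStarModel Γ π → IsLexModel π′ → π′ ⊒ π → π′ ⊨*Γ Γ → π′ ≡ π
    maximal-⊒⇒≡ {π = π} _ _ ([] , refl) _ = ++-identityʳ π
    maximal-⊒⇒≡ {π = π} (_ , _ , maximal) lex′ (x ∷ xs , refl) star =
      ⊥-elim (maximal _ lex′ (properlyExtends , (x ∷ xs , refl)) star)
      where
      properlyExtends : π ++ x ∷ xs ≢ π
      properlyExtends eq with ++-identityʳ-unique π (sym eq)
      ... | ()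

    maximal-∘ˡ-≡ : ∀ {Γ} → StronglyCompositionalSet Γ → ∀ {π π′} → MaximalStarModel Γ π →
                   IsLexModel π′ → π′ ⊨Γ Γ → π ∘ˡ π′ ≡ π
    maximal-∘ˡ-≡ sc {π} {π′} m@(lex , star , _) lex′ sat =
      maximal-⊒⇒≡ m lex∘ (∘ˡ-⊒ π π′) (⊨Γ⇒⊨*Γ lex∘ (∘ˡ-⊨Γ sc lex lex′ star sat))
      where
      lex∘ : IsLexModel (π ∘ˡ π′)
      lex∘ = ∘ˡ-isLexModel π π′ lex lex′

    consistent⇒maximal-⊨Γ : ∀ {Γ} → StronglyCompositionalSet Γ → ∀ {π} → MaximalStarModel Γ π →
                            Consistent Γ → π ⊨Γ Γ
    consistent⇒maximal-⊨Γ sc {π} m@(lex , star , _) (π′ , lex′ , sat) =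
      subst (_⊨Γ _) (maximal-∘ˡ-≡ sc m lex′ sat) (∘ˡ-⊨Γ sc lex lex′ star sat)

corollary1 : (n : ℕ) (D : Fin n → ℕ) → (∀ X → 1 ≤ D X) →
    (L : Set) (_⊨_ : Lex.Seq n D → L → Set) (Γ : L → Set) →
    Lex.Sat.StronglyCompositionalSet n D L _⊨_ Γ →
    (π : Lex.Seq n D) → Lex.Sat.MaximalStarModel n D L _⊨_ Γ π →
    (Lex.Sat.Consistent n D L _⊨_ Γ → Lex.Sat._⊨Γ_ n D L _⊨_ π Γ) ×
    (Lex.Sat._⊨Γ_ n D L _⊨_ π Γ → Lex.Sat.Consistent n D L _⊨_ Γ)
corollary1 n D _ L _⊨_ Γ sc π m@(lex , _) =
  consistent⇒maximal-⊨Γ sc m , λ sat → π , lex , sat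
  where open LexModels.Satisfaction n D L _⊨_
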